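{- Let $r,m,s$ be positive integers with $m>r$. Then $\mathrm{SG}((r+1)^m,r^s)=0$ if $r+m$ is even and $=1$ if $r+m$ is odd.
   Context: $((r+1)^m,r^s)$ is the partition with $m$ parts equal to $r+1$ followed by $s$ parts equal to $r$. LCTR: from nonempty $\lambda=(\lambda_1,\dots,\lambda_k)$ one may move to $T(\lambda)=(\lambda_2,\dots,\lambda_k)$ or $L(\lambda)=(\lambda_1-1,\dots,\lambda_k-1)$ (nonpositive entries omitted); $()$ has no moves. $\mathrm{SG}(())=0$, $\mathrm{SG}(\lambda)=\mathrm{mex}\{\mathrm{SG}(L(\lambda)),\mathrm{SG}(T(\lambda))\}$ otherwise, with $\mathrm{mex}(B)$ the least nonnegative integer not in $B$. -}

module Defs where

open import Data.Nat using (ℕ; zero; suc; _+_; _∸_; _≟_)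
open import Data.List using (List; []; _∷_; _++_; replicate; map; filter)
open import Data.Nat.ListAction using (sum)
open import Data.Bool using (Bool; true; false; _∨_)
open import Relation.Nullary using (¬_)
open import Relation.Nullary.Decidable using (⌊_⌋)
open import Data.Nat.DivMod using (_%_)
open import Relation.Binary.PropositionalEquality using (_≡_)

-- A partition is a weakly decreasing list of positive naturals.
Partition : Set
Partition = List ℕ

T : Partition → Partition
T []       = []
T (_ ∷ xs) = xs

L : Partition → Partition
L xs = filter (λ x → ¬? (x ≟ 0)) (map (λ x → x ∸ 1) xs)
  where
    open import Relation.Nullary.Decidable using (¬?)

mex₂ : ℕ → ℕ → ℕ
mex₂ a b with ⌊ a ≟ 0 ⌋ ∨ ⌊ b ≟ 0 ⌋
... | false = 0
... | true  with ⌊ a ≟ 1 ⌋ ∨ ⌊ b ≟ 1 ⌋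
...   | false = 1
...   | true  = 2

-- Sprague–Grundy value computed with fuel; each move strictly decreases
-- the sum of parts of a partition with positive parts, so fuel = sum λ
-- (plus one) suffices for the recursion to reach ().
SGf : ℕ → Partition → ℕ
SGf _       []         = 0
SGf zero    (_ ∷ _)    = 0
SGf (suc n) xs@(_ ∷ _) = mex₂ (SGf n (L xs)) (SGf n (T xs))

SG : Partition → ℕ
SG xs = SGf (suc (sum xs)) xs

blockPartition : ℕ → ℕ → ℕ → Partition
blockPartition r m s = replicate m (suc r) ++ replicate s r

Even : ℕ → Set
Even n = n % 2 ≡ 0

Odd : ℕ → Set
Odd n = n % 2 ≡ 1

-- Away from the boundary, the move T lowers m and the move L lowers r; both options
-- lie in the same family with r + m one smaller, so by induction they share the value
-- c = (r + m - 1) mod 2 and the position gets mex {c} = 1 - c.  Two boundary families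
-- need care.  For r = 1 the move L reaches 1^m, whose value (1 or 2) is never 0 and
-- so does not disturb the mex.  For m = r + 1 the move L gives value 0, while the move
-- T reaches (r+1)^r r^s, whose own L-option has value 1, so its value is not 1; hence
-- the mex is 1.  The corner r = 1, m = 2 is computed directly.
module Submission where

open import Defs
open import Data.Nat using (ℕ; zero; suc; _+_; _*_; _<_; _≤_; z≤n; s≤s)
open import Data.Nat.Properties
  using ( ≤-refl; ≤-trans; <-≤-trans; m≤n+m; n≤1+n; m<n⇒m<1+n; m≤n⇒m<n∨m≡n
        ; +-monoʳ-≤; +-suc)
open import Data.Nat.DivMod using (_%_; [m+kn]%n≡m%n)
open import Data.Nat.ListAction using (sum)
open import Data.Nat.Tactic.RingSolver using (solve-∀)
open import Data.List using ([]; _∷_; _++_; replicate)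
open import Data.List.Properties using (++-identityʳ)
open import Data.List.Relation.Unary.All using (All; []; _∷_)
open import Data.List.Relation.Unary.All.Properties using (++⁺; replicate⁺)
open import Data.Product using (_×_; _,_)
open import Data.Sum using (_⊎_; inj₁; inj₂)
open import Data.Empty using (⊥-elim)
open import Relation.Binary.PropositionalEquality
  using (_≡_; _≢_; refl; sym; trans; cong; cong₂; subst; module ≡-Reasoning)
open ≡-Reasoning

mex₂-≢ˡ : ∀ a b → mex₂ a b ≢ a
mex₂-≢ˡ zero zero = λ ()
mex₂-≢ˡ zero (suc zero) = λ ()
mex₂-≢ˡ zero (suc (suc b)) = λ ()
mex₂-≢ˡ (suc zero) zero = λ ()
mex₂-≢ˡ (suc zero) (suc zero) = λ ()
mex₂-≢ˡ (suc zero) (suc (suc b)) = λ ()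
mex₂-≢ˡ (suc (suc a)) zero = λ ()
mex₂-≢ˡ (suc (suc a)) (suc zero) = λ ()
mex₂-≢ˡ (suc (suc a)) (suc (suc b)) = λ ()

mex₂-≡1 : ∀ {a b} → a ≡ 0 → b ≢ 1 → mex₂ a b ≡ 1
mex₂-≡1 {b = zero} refl _ = refl
mex₂-≡1 {b = suc zero} refl b≢1 = ⊥-elim (b≢1 refl)
mex₂-≡1 {b = suc (suc b)} refl _ = refl

mex₂[1,1+n]≡0 : ∀ n → mex₂ 1 (suc n) ≡ 0
mex₂[1,1+n]≡0 zero = refl
mex₂[1,1+n]≡0 (suc n) = refl

-- (2 + n) % 2 reduces to n % 2, so parity facts follow by recursion in steps of two.
mex₂[n%2,n%2]≡[1+n]%2 : ∀ n → mex₂ (n % 2) (n % 2) ≡ suc n % 2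
mex₂[n%2,n%2]≡[1+n]%2 zero = refl
mex₂[n%2,n%2]≡[1+n]%2 (suc zero) = refl
mex₂[n%2,n%2]≡[1+n]%2 (suc (suc n)) = mex₂[n%2,n%2]≡[1+n]%2 n

mex₂[0,1+n%2]≡1+[1+n]%2 : ∀ n → mex₂ 0 (suc (n % 2)) ≡ suc (suc n % 2)
mex₂[0,1+n%2]≡1+[1+n]%2 zero = refl
mex₂[0,1+n%2]≡1+[1+n]%2 (suc zero) = refl
mex₂[0,1+n%2]≡1+[1+n]%2 (suc (suc n)) = mex₂[0,1+n%2]≡1+[1+n]%2 n

mex₂[1+n%2,[1+n]%2]≡n%2 : ∀ n → mex₂ (suc (n % 2)) (suc n % 2) ≡ n % 2
mex₂[1+n%2,[1+n]%2]≡n%2 zero = refl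
mex₂[1+n%2,[1+n]%2]≡n%2 (suc zero) = refl
mex₂[1+n%2,[1+n]%2]≡n%2 (suc (suc n)) = mex₂[1+n%2,[1+n]%2]≡n%2 n

[n+[m+n]]%2≡m%2 : ∀ n m → (n + (m + n)) % 2 ≡ m % 2
[n+[m+n]]%2≡m%2 n m = trans (cong (_% 2) (rearrange n m)) ([m+kn]%n≡m%n m n 2)
  where
  rearrange : ∀ n m → n + (m + n) ≡ m + n * 2
  rearrange = solve-∀

Positive : Partition → Set
Positive = All (_≢ 0)

L-positive : ∀ xs → Positive (L xs)
L-positive [] = []
L-positive (zero ∷ xs) = L-positive xs
L-positive (suc zero ∷ xs) = L-positive xs
L-positive (suc (suc x) ∷ xs) = (λ ()) ∷ L-positive xs

block-positive : ∀ k m s → Positive (blockPartition (suc k) m s)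
block-positive k m s = ++⁺ (replicate⁺ m λ ()) (replicate⁺ s λ ())

sum-L-≤ : ∀ xs → sum (L xs) ≤ sum xs
sum-L-≤ [] = ≤-refl
sum-L-≤ (zero ∷ xs) = sum-L-≤ xs
sum-L-≤ (suc zero ∷ xs) = ≤-trans (sum-L-≤ xs) (n≤1+n _)
sum-L-≤ (suc (suc x) ∷ xs) = s≤s (≤-trans (+-monoʳ-≤ x (sum-L-≤ xs)) (n≤1+n _))

sum-L-< : ∀ x xs → sum (L (suc x ∷ xs)) < sum (suc x ∷ xs)
sum-L-< zero xs = s≤s (sum-L-≤ xs)
sum-L-< (suc x) xs = s≤s (+-monoʳ-≤ (suc x) (sum-L-≤ xs))

-- Every move from a partition with positive parts lowers the sum, so any fuel
-- exceeding the sum gives the same value.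
SGf-fuel : ∀ {m n} xs → Positive xs → sum xs < m → sum xs < n → SGf m xs ≡ SGf n xs
SGf-fuel [] _ _ _ = refl
SGf-fuel (zero ∷ xs) (0≢0 ∷ _) _ _ = ⊥-elim (0≢0 refl)
SGf-fuel {suc m} {suc n} (suc x ∷ xs) (_ ∷ ps) (s≤s x+xs<m) (s≤s x+xs<n) = cong₂ mex₂
  (SGf-fuel (L (suc x ∷ xs)) (L-positive (suc x ∷ xs))
    (<-≤-trans (sum-L-< x xs) x+xs<m) (<-≤-trans (sum-L-< x xs) x+xs<n))
  (SGf-fuel xs ps
    (≤-trans (s≤s (m≤n+m (sum xs) x)) x+xs<m) (≤-trans (s≤s (m≤n+m (sum xs) x)) x+xs<n))

SG-unfold : ∀ x xs → Positive xs → SG (suc x ∷ xs) ≡ mex₂ (SG (L (suc x ∷ xs))) (SG xs)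
SG-unfold x xs ps = cong₂ mex₂
  (SGf-fuel (L (suc x ∷ xs)) (L-positive (suc x ∷ xs)) (sum-L-< x xs) ≤-refl)
  (SGf-fuel xs ps (s≤s (m≤n+m (sum xs) x)) ≤-refl)

L-++ : ∀ xs ys → L (xs ++ ys) ≡ L xs ++ L ys
L-++ [] ys = refl
L-++ (zero ∷ xs) ys = L-++ xs ys
L-++ (suc zero ∷ xs) ys = L-++ xs ys
L-++ (suc (suc x) ∷ xs) ys = cong (suc x ∷_) (L-++ xs ys)

L-replicate : ∀ m n → L (replicate m (suc (suc n))) ≡ replicate m (suc n)
L-replicate zero n = refl
L-replicate (suc m) n = cong (suc n ∷_) (L-replicate m n)

L-replicate-1 : ∀ m → L (replicate m 1) ≡ []
L-replicate-1 zero = refl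
L-replicate-1 (suc m) = L-replicate-1 m

L-block : ∀ k m s → L (blockPartition (suc (suc k)) m s) ≡ blockPartition (suc k) m s
L-block k m s =
  trans (L-++ (replicate m _) _) (cong₂ _++_ (L-replicate m (suc k)) (L-replicate s k))

L-block-1 : ∀ m s → L (blockPartition 1 m s) ≡ replicate m 1
L-block-1 m s = begin
  L (replicate m 2 ++ replicate s 1)     ≡⟨ L-++ (replicate m 2) _ ⟩
  L (replicate m 2) ++ L (replicate s 1) ≡⟨ cong₂ _++_ (L-replicate m 0) (L-replicate-1 s) ⟩
  replicate m 1 ++ []                    ≡⟨ ++-identityʳ _ ⟩
  replicate m 1                          ∎

SG-block-unfold : ∀ k m s → SG (blockPartition (suc k) (suc m) s) ≡
  mex₂ (SG (L (blockPartition (suc k) (suc m) s))) (SG (blockPartition (suc k) m s))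
SG-block-unfold k m s = SG-unfold (suc k) (blockPartition (suc k) m s) (block-positive k m s)

SG-block-suc : ∀ k m s → SG (blockPartition (suc (suc k)) (suc m) s) ≡
  mex₂ (SG (blockPartition (suc k) (suc m) s)) (SG (blockPartition (suc (suc k)) m s))
SG-block-suc k m s =
  subst (λ xs → SG (blockPartition (suc (suc k)) (suc m) s) ≡
                mex₂ (SG xs) (SG (blockPartition (suc (suc k)) m s)))
    (L-block k (suc m) s) (SG-block-unfold (suc k) m s)

SG-block-one-suc : ∀ m s → SG (blockPartition 1 (suc m) s) ≡
  mex₂ (SG (replicate (suc m) 1)) (SG (blockPartition 1 m s))
SG-block-one-suc m s =
  subst (λ xs → SG (blockPartition 1 (suc m) s) ≡ mex₂ (SG xs) (SG (blockPartition 1 m s)))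
    (L-block-1 (suc m) s) (SG-block-unfold 0 m s)

SG-block-suc-≢ : ∀ k m s →
  SG (blockPartition (suc (suc k)) (suc m) s) ≢ SG (blockPartition (suc k) (suc m) s)
SG-block-suc-≢ k m s eq =
  mex₂-≢ˡ (SG (blockPartition (suc k) (suc m) s)) (SG (blockPartition (suc (suc k)) m s))
    (trans (sym (SG-block-suc k m s)) eq)

SG-ones : ∀ n → SG (replicate (suc n) 1) ≡ suc (n % 2)
SG-ones zero = refl
SG-ones (suc n) = begin
  SG (replicate (suc (suc n)) 1)
    ≡⟨ SG-unfold 0 (replicate (suc n) 1) (replicate⁺ (suc n) λ ()) ⟩
  mex₂ (SG (L (replicate (suc (suc n)) 1))) (SG (replicate (suc n) 1))
    ≡⟨ cong₂ mex₂ (cong SG (L-replicate-1 (suc (suc n)))) (SG-ones n) ⟩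
  mex₂ 0 (suc (n % 2))
    ≡⟨ mex₂[0,1+n%2]≡1+[1+n]%2 n ⟩
  suc (suc n % 2) ∎

module _ (t : ℕ) where

  SG-block : ∀ k m → suc k < m → SG (blockPartition (suc k) m (suc t)) ≡ (suc k + m) % 2
  SG-block-split : ∀ k m → suc (suc k) < m ⊎ suc (suc k) ≡ m →
    SG (blockPartition (suc (suc k)) (suc m) (suc t)) ≡ (suc (suc k) + suc m) % 2

  SG-block zero (suc (suc zero)) _ = begin
    SG (blockPartition 1 2 (suc t))
      ≡⟨ SG-block-one-suc 1 (suc t) ⟩
    mex₂ (SG (replicate 2 1)) (SG (blockPartition 1 1 (suc t)))
      ≡⟨ cong₂ mex₂ (SG-ones 1) SG-T ⟩
    mex₂ 2 0
      ≡⟨⟩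
    1 ∎
    where
    SG-T : SG (blockPartition 1 1 (suc t)) ≡ 0
    SG-T = begin
      SG (blockPartition 1 1 (suc t))
        ≡⟨ SG-block-one-suc 0 (suc t) ⟩
      mex₂ 1 (SG (replicate (suc t) 1))
        ≡⟨ cong (mex₂ 1) (SG-ones t) ⟩
      mex₂ 1 (suc (t % 2))
        ≡⟨ mex₂[1,1+n]≡0 (t % 2) ⟩
      0 ∎
  SG-block zero (suc (suc (suc m))) _ = begin
    SG (blockPartition 1 (suc (suc (suc m))) (suc t))
      ≡⟨ SG-block-one-suc (suc (suc m)) (suc t) ⟩
    mex₂ (SG (replicate (suc (suc (suc m))) 1)) (SG (blockPartition 1 (suc (suc m)) (suc t)))
      ≡⟨ cong₂ mex₂ (SG-ones (suc (suc m))) (SG-block 0 (suc (suc m)) (s≤s (s≤s z≤n))) ⟩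
    mex₂ (suc (m % 2)) (suc m % 2)
      ≡⟨ mex₂[1+n%2,[1+n]%2]≡n%2 m ⟩
    m % 2 ∎
  SG-block zero (suc zero) (s≤s ())
  SG-block (suc k) (suc m) (s≤s 2+k≤m) = SG-block-split k m (m≤n⇒m<n∨m≡n 2+k≤m)

  SG-block-split k m (inj₂ refl) = begin
    SG (blockPartition (suc (suc k)) (suc (suc (suc k))) (suc t))
      ≡⟨ SG-block-suc k (suc (suc k)) (suc t) ⟩
    mex₂ (SG (blockPartition (suc k) (suc (suc (suc k))) (suc t)))
         (SG (blockPartition (suc (suc k)) (suc (suc k)) (suc t)))
      ≡⟨ mex₂-≡1 SG-L SG-T ⟩
    1
      ≡⟨ sym ([n+[m+n]]%2≡m%2 (suc (suc k)) 1) ⟩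
    (suc (suc k) + suc (suc (suc k))) % 2 ∎
    where
    SG-L : SG (blockPartition (suc k) (suc (suc (suc k))) (suc t)) ≡ 0
    SG-L = trans (SG-block k (suc (suc (suc k))) (s≤s (s≤s (n≤1+n k))))
      ([n+[m+n]]%2≡m%2 (suc k) 2)
    SG-TL : SG (blockPartition (suc k) (suc (suc k)) (suc t)) ≡ 1
    SG-TL = trans (SG-block k (suc (suc k)) ≤-refl) ([n+[m+n]]%2≡m%2 (suc k) 1)
    SG-T : SG (blockPartition (suc (suc k)) (suc (suc k)) (suc t)) ≢ 1
    SG-T eq = SG-block-suc-≢ k (suc k) (suc t) (trans eq (sym SG-TL))
  SG-block-split k (suc m) (inj₁ (s≤s 1+k<m)) = begin
    SG (blockPartition (suc (suc k)) (suc (suc m)) (suc t))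
      ≡⟨ SG-block-suc k (suc m) (suc t) ⟩
    mex₂ (SG (blockPartition (suc k) (suc (suc m)) (suc t)))
         (SG (blockPartition (suc (suc k)) (suc m) (suc t)))
      ≡⟨ cong₂ mex₂ SG-L (SG-block-split k m (m≤n⇒m<n∨m≡n 1+k<m)) ⟩
    mex₂ (n % 2) (n % 2)
      ≡⟨ mex₂[n%2,n%2]≡[1+n]%2 n ⟩
    suc n % 2
      ≡⟨ cong (_% 2) (sym (+-suc (suc (suc k)) (suc m))) ⟩
    (suc (suc k) + suc (suc m)) % 2 ∎
    where
    n = suc (suc k) + suc m
    SG-L : SG (blockPartition (suc k) (suc (suc m)) (suc t)) ≡ n % 2
    SG-L = trans (SG-block k (suc (suc m)) (m<n⇒m<1+n (m<n⇒m<1+n 1+k<m)))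
      (cong (λ x → suc x % 2) (+-suc k (suc m)))

lemma3p13 : (r m s : ℕ) → 1 ≤ r → 1 ≤ m → 1 ≤ s → r < m →
    (Even (r + m) → SG (blockPartition r m s) ≡ 0) ×
    (Odd (r + m) → SG (blockPartition r m s) ≡ 1)
lemma3p13 (suc k) m (suc t) _ _ _ r<m = trans value , trans value
  where
  value : SG (blockPartition (suc k) m (suc t)) ≡ (suc k + m) % 2
  value = SG-block t k m r<m
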